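{- Let $G$ be a finite connected graph with a harmonic action of $D_n=\langle\sigma_1,\sigma_2\rangle$ ($n\ge 2$) as described in the context, with vertices labeled $z_i^j$ ($1\le j\le s$) and $x_i^j,y_i^j$ ($1\le j\le t$), $i\in\{1,\dots,n\}$. Let $\mathcal{L}$ be the subgroup of divisors on $G$ generated by all $\Delta_v$, and let $\mathcal{L}'\subseteq\mathcal{L}$ be the subgroup generated by: $\Delta_{z_i^j}$ for all $i,j$; $\Delta_{x_{i_1}^j}+\Delta_{y_{i_2}^j}$ for all $i_1,i_2,j$; $\sum_{i=1}^n\Delta_{x_i^j}$ for each $j$; and $\sum_{i=1}^n\Delta_{y_i^j}$ for each $j$. Then $\mathcal{L}/\mathcal{L}'\cong(\mathbb{Z}/n\mathbb{Z})^t$.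
   Context: Graphs are finite, connected, may have multiple edges, no loops. A divisor is a function from vertices to $\mathbb{Z}$. For a vertex $v$, $\Delta_v$ is the divisor with $\Delta_v(v)=-\deg(v)$ and $\Delta_v(w)$ equal to the number of edges between $v$ and $w$ for $w\ne v$ (firing $v$). Setting: $D_n$ is the dihedral group of order $2n$ generated by involutions $\sigma_1,\sigma_2$, acting on $G$ by automorphisms harmonically (no non-identity element fixes both endpoints of an edge), and every $D_n$-orbit of vertices has $n$ or $2n$ points. The vertices are labeled so that there are $s$ orbits of size $n$, $\{z_i^j: i=1,\dots,n\}$, $j=1,\dots,s$, and $t$ orbits of size $2n$, $\{x_i^j,y_i^j\}$, $j=1,\dots,t$, with (subscripts mod $n$) $\sigma_1(z_i^j)=z_{n+1-i}^j$, $\sigma_1(x_i^j)=y_{n+1-i}^j$, $\sigma_1(y_i^j)=x_{n+1-i}^j$, $\sigma_2(z_i^j)=z_{n+2-i}^j$, $\sigma_2(x_i^j)=y_{n+2-i}^j$, $\sigma_2(y_i^j)=x_{n+2-i}^j$. -}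

module Defs where

open import Data.Nat as ℕ using (ℕ; zero; suc; NonZero; _%_)
import Data.Nat.Properties as ℕP
import Data.Nat.DivMod as ℕD
open import Data.Fin as Fin using (Fin; toℕ; fromℕ<)
import Data.Fin.Properties as FinP
open import Data.Integer as ℤ using (ℤ; +_; _+_; _-_; -_)
open import Data.Integer.Divisibility using (_∣_)
open import Data.Bool using (Bool; true; false)
open import Data.Product using (Σ; _×_; _,_; proj₁; proj₂)
open import Data.Empty using (⊥)
open import Relation.Nullary using (¬_; Dec; yes; no)
open import Relation.Binary.PropositionalEquality using (_≡_; refl; cong; cong₂)
open import Algebra.Bundles.Raw using (RawGroup)

-- Vertices.  Labels i ∈ {1,…,n} of the paper are encoded 0-based as
-- Fin n (paper label i  ↔  toℕ index = i - 1).
--   z j i  = z_{i+1}^{j+1},  x j i = x_{i+1}^{j+1},  y j i = y_{i+1}^{j+1}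

data V (s t n : ℕ) : Set where
  z : Fin s → Fin n → V s t n
  x : Fin t → Fin n → V s t n
  y : Fin t → Fin n → V s t n

_≟V_ : ∀ {s t n} → (v w : V s t n) → Dec (v ≡ w)
z j i ≟V z j' i' with j Fin.≟ j' | i Fin.≟ i'
... | yes refl | yes refl = yes refl
... | no ne | _ = no λ { refl → ne refl }
... | yes _ | no ne = no λ { refl → ne refl }
z _ _ ≟V x _ _ = no λ ()
z _ _ ≟V y _ _ = no λ ()
x _ _ ≟V z _ _ = no λ ()
x j i ≟V x j' i' with j Fin.≟ j' | i Fin.≟ i'
... | yes refl | yes refl = yes refl
... | no ne | _ = no λ { refl → ne refl }
... | yes _ | no ne = no λ { refl → ne refl }
x _ _ ≟V y _ _ = no λ ()
y _ _ ≟V z _ _ = no λ ()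
y _ _ ≟V x _ _ = no λ ()
y j i ≟V y j' i' with j Fin.≟ j' | i Fin.≟ i'
... | yes refl | yes refl = yes refl
... | no ne | _ = no λ { refl → ne refl }
... | yes _ | no ne = no λ { refl → ne refl }

mod : (n : ℕ) .{{_ : NonZero n}} → ℕ → Fin n
mod n k = fromℕ< (ℕD.m%n<n k n)

-- 0-based versions of the paper's index maps:
--   i ↦ n+1-i  becomes  i' ↦ (2n - 1 - i') mod n
--   i ↦ n+2-i  becomes  i' ↦ (2n - i') mod n
--   rotation by k: i' ↦ (i' + k) mod n
refl₁ : (n : ℕ) .{{_ : NonZero n}} → Fin n → Fin n
refl₁ n i = mod n ((n ℕ.+ n) ℕ.∸ 1 ℕ.∸ toℕ i)

refl₂ : (n : ℕ) .{{_ : NonZero n}} → Fin n → Fin n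
refl₂ n i = mod n ((n ℕ.+ n) ℕ.∸ toℕ i)

shift : (n : ℕ) .{{_ : NonZero n}} → ℕ → Fin n → Fin n
shift n k i = mod n (toℕ i ℕ.+ k)

module _ {s t n : ℕ} .{{_ : NonZero n}} where

  σ₁ : V s t n → V s t n
  σ₁ (z j i) = z j (refl₁ n i)
  σ₁ (x j i) = y j (refl₁ n i)
  σ₁ (y j i) = x j (refl₁ n i)

  σ₂ : V s t n → V s t n
  σ₂ (z j i) = z j (refl₂ n i)
  σ₂ (x j i) = y j (refl₂ n i)
  σ₂ (y j i) = x j (refl₂ n i)

  -- ρ = σ₂ ∘ σ₁ acts as rotation by one; ρᵏ is rotation by k.
  rot : ℕ → V s t n → V s t n
  rot k (z j i) = z j (shift n k i)
  rot k (x j i) = x j (shift n k i)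
  rot k (y j i) = y j (shift n k i)

  -- The elements of D_n = ⟨σ₁,σ₂⟩ (order 2n) in normal form ρᵏ σ₁ᵇ,
  -- k ∈ {0,…,n-1}, b ∈ {0,1}; the identity is (0 , false).
  DihedralElt : Set
  DihedralElt = Fin n × Bool

  act : DihedralElt → V s t n → V s t n
  act (k , false) v = rot (toℕ k) v
  act (k , true)  v = rot (toℕ k) (σ₁ v)

  IsIdentity : DihedralElt → Set
  IsIdentity (k , b) = (toℕ k ≡ 0) × (b ≡ false)

sumFin : ∀ {m} → (Fin m → ℤ) → ℤ
sumFin {zero}  f = + 0
sumFin {suc m} f = f Fin.zero + sumFin (λ i → f (Fin.suc i))

sumV : ∀ {s t n} → (V s t n → ℤ) → ℤ
sumV f = sumFin (λ j → sumFin (λ i → f (z j i)))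
       + sumFin (λ j → sumFin (λ i → f (x j i)))
       + sumFin (λ j → sumFin (λ i → f (y j i)))

-- Graphs (finite: vertex set V s t n; connected; multiple edges allowed
-- via an adjacency multiplicity function; no loops) with a harmonic
-- D_n action given by σ₁, σ₂ above.

data Reachable {s t n : ℕ} (A : V s t n → V s t n → ℕ) (v : V s t n) : V s t n → Set where
  here : Reachable A v v
  step : ∀ {u w} → Reachable A v u → 0 ℕ.< A u w → Reachable A v w

record DnGraph (s t n : ℕ) .{{_ : NonZero n}} : Set where
  field
    adj       : V s t n → V s t n → ℕ
    adj-sym   : ∀ v w → adj v w ≡ adj w v
    no-loops  : ∀ v → adj v v ≡ 0
    connected : ∀ v w → Reachable adj v w
    σ₁-aut    : ∀ v w → adj (σ₁ v) (σ₁ w) ≡ adj v w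
    σ₂-aut    : ∀ v w → adj (σ₂ v) (σ₂ w) ≡ adj v w
    harmonic  : ∀ (g : DihedralElt {s} {t} {n}) → ¬ IsIdentity {s} {t} {n} g →
                ∀ v w → 0 ℕ.< adj v w → ¬ ((act g v ≡ v) × (act g w ≡ w))

Div : ℕ → ℕ → ℕ → Set
Div s t n = V s t n → ℤ

module _ {s t n : ℕ} .{{_ : NonZero n}} (G : DnGraph s t n) where
  open DnGraph G

  deg : V s t n → ℤ
  deg v = sumV (λ w → + adj v w)

  Δ : V s t n → Div s t n
  Δ v w with v ≟V w
  ... | yes _ = - deg v
  ... | no _  = + adj v w

data _∈⟨_⟩ {s t n : ℕ} {I : Set} (D : Div s t n) (gen : I → Div s t n) : Set where
  sg-zero : (∀ v → D v ≡ + 0) → D ∈⟨ gen ⟩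
  sg-gen  : ∀ i → (∀ v → D v ≡ gen i v) → D ∈⟨ gen ⟩
  sg-add  : ∀ {D₁ D₂} → D₁ ∈⟨ gen ⟩ → D₂ ∈⟨ gen ⟩ → (∀ v → D v ≡ D₁ v + D₂ v) → D ∈⟨ gen ⟩
  sg-neg  : ∀ {D₁} → D₁ ∈⟨ gen ⟩ → (∀ v → D v ≡ - D₁ v) → D ∈⟨ gen ⟩

module _ {s t n : ℕ} .{{_ : NonZero n}} (G : DnGraph s t n) where

  LGen : V s t n → Div s t n
  LGen = Δ G

  data L'Index : Set where
    gz   : Fin s → Fin n → L'Index
    gxy  : Fin t → Fin n → Fin n → L'Index
    gxs  : Fin t → L'Index
    gys  : Fin t → L'Index

  L'Gen : L'Index → Div s t n
  L'Gen (gz j i)       w = Δ G (z j i) w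
  L'Gen (gxy j i₁ i₂)  w = Δ G (x j i₁) w + Δ G (y j i₂) w
  L'Gen (gxs j)        w = sumFin (λ i → Δ G (x j i) w)
  L'Gen (gys j)        w = sumFin (λ i → Δ G (y j i) w)

  𝓛 : Set
  𝓛 = Σ (Div s t n) (λ D → D ∈⟨ LGen ⟩)

  𝓛/𝓛' : RawGroup _ _
  𝓛/𝓛' = record
    { Carrier = 𝓛
    ; _≈_     = λ D E → (λ v → proj₁ D v - proj₁ E v) ∈⟨ L'Gen ⟩
    ; _∙_     = λ D E → (λ v → proj₁ D v + proj₁ E v)
                       , sg-add (proj₂ D) (proj₂ E) (λ v → refl)
    ; ε       = (λ v → + 0) , sg-zero (λ v → refl)
    ; _⁻¹     = λ D → (λ v → - proj₁ D v) , sg-neg (proj₂ D) (λ v → refl)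
    }

ZnPow : (n t : ℕ) → RawGroup _ _
ZnPow n t = record
  { Carrier = Fin t → ℤ
  ; _≈_     = λ a b → ∀ j → (+ n) ∣ (a j - b j)
  ; _∙_     = λ a b j → a j + b j
  ; ε       = λ j → + 0
  ; _⁻¹     = λ a j → - a j
  }

module Submission where

-- A divisor in 𝓛 is fire a = Σ_v a(v) Δ_v for an integer firing script a, and since G is connected
-- the script is unique up to an additive constant: if fire d = 0 then d is harmonic and, by the
-- maximum principle, constant.  The orbit imbalances Σ_i a(x_i^j) - Σ_i a(y_i^j) vanish on constants,
-- hence give a homomorphism 𝓛 → ℤ^t, and every generator of 𝓛' has imbalances divisible by n.
-- Conversely, modulo 𝓛' one has Δ_z ≡ 0, Δ_{x_i^j} ≡ Δ_{x_{i₀}^j} and Δ_{y_i^j} ≡ -Δ_{x_{i₀}^j}, so that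
-- fire a ≡ Σ_j imbalance_j(a) Δ_{x_{i₀}^j}, while n Δ_{x_{i₀}^j} = Σ_i Δ_{x_i^j} - Σ_i (Δ_{x_i^j} - Δ_{x_{i₀}^j})
-- lies in 𝓛'.  Hence 𝓛' is exactly the preimage of (nℤ)^t, and the map is onto since firing x_{i₀}^j
-- c_j times has imbalance c.

open import Defs
open import Algebra.Morphism.Structures using (module GroupMorphisms)
open import Data.Fin as Fin using (Fin; zero; suc)
open import Data.Fin.Properties using (suc-injective)
open import Data.Integer using (ℤ; +_; -[1+_]; _+_; _-_; -_; _*_; _≤_)
open import Data.Integer.Properties
open import Algebra.Properties.CommutativeSemigroup +-commutativeSemigroup using (interchange)
open import Algebra.Properties.Ring +-*-ring using (x[y-z]≈xy-xz)
import Data.Integer.Divisibility as Unsigned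
open import Data.Integer.Divisibility.Signed
  using (_∣_; divides; ∣m∣n⇒∣m+n; ∣m⇒∣-m; ∣⇒∣ᵤ; ∣ᵤ⇒∣)
open import Data.Integer.Tactic.RingSolver using (solve-∀)
open import Data.List using (List; _++_; cartesianProductWith; allFin)
open import Data.List.Extrema ≤-totalOrder using (argmax; f[xs]≤f[argmax])
open import Data.List.Membership.Propositional using (_∈_)
open import Data.List.Membership.Propositional.Properties
  using (∈-++⁺ˡ; ∈-++⁺ʳ; ∈-cartesianProductWith⁺; ∈-allFin)
open import Data.List.Relation.Unary.All using (lookup)
open import Data.Nat as ℕ using (ℕ; zero; suc; NonZero)
import Data.Nat.Properties as ℕ
open import Data.Product using (∃; _×_; _,_; proj₁; proj₂)
open import Data.Sum using (inj₁; inj₂)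
open import Function using (_∘_)
open import Relation.Nullary using (¬_; Dec; yes; no; contradiction)
open import Relation.Binary.PropositionalEquality

private variable
  k m s t n : ℕ

sumFin-cong : {f g : Fin m → ℤ} → (∀ i → f i ≡ g i) → sumFin f ≡ sumFin g
sumFin-cong {zero}  eq = refl
sumFin-cong {suc m} eq = cong₂ _+_ (eq zero) (sumFin-cong (eq ∘ suc))

sumFin-+ : (f g : Fin m → ℤ) → sumFin (λ i → f i + g i) ≡ sumFin f + sumFin g
sumFin-+ {zero}  f g = refl
sumFin-+ {suc m} f g =
  trans (cong (_+_ (f zero + g zero)) (sumFin-+ (f ∘ suc) (g ∘ suc)))
        (interchange (f zero) (g zero) _ _)

sumFin-*ˡ : (c : ℤ) (f : Fin m → ℤ) → sumFin (λ i → c * f i) ≡ c * sumFin f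
sumFin-*ˡ {zero}  c f = sym (*-zeroʳ c)
sumFin-*ˡ {suc m} c f =
  trans (cong (_+_ (c * f zero)) (sumFin-*ˡ c (f ∘ suc))) (sym (*-distribˡ-+ c (f zero) _))

sumFin-*ʳ : (c : ℤ) (f : Fin m → ℤ) → sumFin (λ i → f i * c) ≡ sumFin f * c
sumFin-*ʳ c f = trans (sumFin-cong (λ i → *-comm (f i) c)) (trans (sumFin-*ˡ c f) (*-comm c _))

sumFin-neg : (f : Fin m → ℤ) → sumFin (λ i → - f i) ≡ - sumFin f
sumFin-neg f =
  trans (sumFin-cong (λ i → sym (-1*i≡-i (f i)))) (trans (sumFin-*ˡ (- + 1) f) (-1*i≡-i _))

sumFin-- : (f g : Fin m → ℤ) → sumFin (λ i → f i - g i) ≡ sumFin f - sumFin g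
sumFin-- f g = trans (sumFin-+ f (λ i → - g i)) (cong (_+_ (sumFin f)) (sumFin-neg g))

sumFin-const : (c : ℤ) → sumFin {m} (λ _ → c) ≡ + m * c
sumFin-const {zero}  c = refl
sumFin-const {suc m} c = trans (cong (_+_ c) (sumFin-const {m} c)) (sym (suc-* (+ m) c))

sumFin-zero : {f : Fin m → ℤ} → (∀ i → f i ≡ + 0) → sumFin f ≡ + 0
sumFin-zero {m} eq = trans (sumFin-cong eq) (trans (sumFin-const {m} (+ 0)) (*-zeroʳ (+ m)))

sumFin-single : (f : Fin m → ℤ) (k : Fin m) → (∀ i → i ≢ k → f i ≡ + 0) → sumFin f ≡ f k
sumFin-single f zero off =
  trans (cong (_+_ (f zero)) (sumFin-zero (λ i → off (suc i) λ ()))) (+-identityʳ _)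
sumFin-single f (suc k) off =
  trans (cong₂ _+_ (off zero λ ())
                   (sumFin-single (f ∘ suc) k (λ i i≢k → off (suc i) (i≢k ∘ suc-injective))))
        (+-identityˡ _)

i+j≤i : ∀ i {j} → j ≤ + 0 → i + j ≤ i
i+j≤i i j≤0 = ≤-trans (+-monoʳ-≤ i j≤0) (≤-reflexive (+-identityʳ i))

i+j≤j : ∀ {i} j → i ≤ + 0 → i + j ≤ j
i+j≤j j i≤0 = ≤-trans (+-monoˡ-≤ j i≤0) (≤-reflexive (+-identityˡ j))

sumFin-nonpos : {f : Fin m → ℤ} → (∀ i → f i ≤ + 0) → sumFin f ≤ + 0
sumFin-nonpos {zero}  f≤0 = ≤-refl
sumFin-nonpos {suc m} f≤0 = ≤-trans (i+j≤j _ (f≤0 zero)) (sumFin-nonpos (f≤0 ∘ suc))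

sumFin≤term : {f : Fin m → ℤ} → (∀ i → f i ≤ + 0) → ∀ k → sumFin f ≤ f k
sumFin≤term f≤0 zero    = i+j≤i _ (sumFin-nonpos (f≤0 ∘ suc))
sumFin≤term f≤0 (suc k) = ≤-trans (i+j≤j _ (f≤0 zero)) (sumFin≤term (f≤0 ∘ suc) k)

sum2 : (Fin k → Fin m → ℤ) → ℤ
sum2 f = sumFin (λ j → sumFin (f j))

sum2-cong : {f g : Fin k → Fin m → ℤ} → (∀ j i → f j i ≡ g j i) → sum2 f ≡ sum2 g
sum2-cong eq = sumFin-cong (λ j → sumFin-cong (eq j))

sum2-+ : (f g : Fin k → Fin m → ℤ) → sum2 (λ j i → f j i + g j i) ≡ sum2 f + sum2 g
sum2-+ f g =
  trans (sumFin-cong (λ j → sumFin-+ (f j) (g j))) (sumFin-+ (λ j → sumFin (f j)) (λ j → sumFin (g j)))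

sum2-*ˡ : (c : ℤ) (f : Fin k → Fin m → ℤ) → sum2 (λ j i → c * f j i) ≡ c * sum2 f
sum2-*ˡ c f = trans (sumFin-cong (λ j → sumFin-*ˡ c (f j))) (sumFin-*ˡ c (λ j → sumFin (f j)))

sum2-zero : {f : Fin k → Fin m → ℤ} → (∀ j i → f j i ≡ + 0) → sum2 f ≡ + 0
sum2-zero eq = sumFin-zero (λ j → sumFin-zero (eq j))

sum2-single : (f : Fin k → Fin m → ℤ) (j : Fin k) (i : Fin m) →
              (∀ j′ i′ → (j′ , i′) ≢ (j , i) → f j′ i′ ≡ + 0) → sum2 f ≡ f j i
sum2-single f j i off =
  trans (sumFin-single _ j (λ j′ j′≢j → sumFin-zero (λ i′ → off j′ i′ (j′≢j ∘ cong proj₁))))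
        (sumFin-single (f j) i (λ i′ i′≢i → off j i′ (i′≢i ∘ cong proj₂)))

sum2-nonpos : {f : Fin k → Fin m → ℤ} → (∀ j i → f j i ≤ + 0) → sum2 f ≤ + 0
sum2-nonpos f≤0 = sumFin-nonpos (sumFin-nonpos ∘ f≤0)

sum2≤term : {f : Fin k → Fin m → ℤ} → (∀ j i → f j i ≤ + 0) → ∀ j i → sum2 f ≤ f j i
sum2≤term f≤0 j i = ≤-trans (sumFin≤term (sumFin-nonpos ∘ f≤0) j) (sumFin≤term (f≤0 j) i)

module _ {s t n : ℕ} where

  private
    Zs Xs Ys : (V s t n → ℤ) → ℤ
    Zs f = sum2 (λ j i → f (z j i))
    Xs f = sum2 (λ j i → f (x j i))
    Ys f = sum2 (λ j i → f (y j i))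

  sumV-cong : {f g : V s t n → ℤ} → (∀ v → f v ≡ g v) → sumV f ≡ sumV g
  sumV-cong eq =
    cong₂ _+_ (cong₂ _+_ (sum2-cong (λ j i → eq (z j i))) (sum2-cong (λ j i → eq (x j i))))
              (sum2-cong (λ j i → eq (y j i)))

  sumV-+ : (f g : V s t n → ℤ) → sumV (λ v → f v + g v) ≡ sumV f + sumV g
  sumV-+ f g =
    trans (cong₂ _+_ (cong₂ _+_ (sum2-+ (λ j i → f (z j i)) (λ j i → g (z j i)))
                                (sum2-+ (λ j i → f (x j i)) (λ j i → g (x j i))))
                     (sum2-+ (λ j i → f (y j i)) (λ j i → g (y j i))))
    (trans (cong₂ _+_ (sym (interchange (Zs f) (Xs f) (Zs g) (Xs g))) refl)
           (sym (interchange (Zs f + Xs f) (Ys f) (Zs g + Xs g) (Ys g))))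

  sumV-*ˡ : (c : ℤ) (f : V s t n → ℤ) → sumV (λ v → c * f v) ≡ c * sumV f
  sumV-*ˡ c f =
    trans (cong₂ _+_ (cong₂ _+_ (sum2-*ˡ c (λ j i → f (z j i))) (sum2-*ˡ c (λ j i → f (x j i))))
                     (sum2-*ˡ c (λ j i → f (y j i))))
    (trans (cong₂ _+_ (sym (*-distribˡ-+ c (Zs f) (Xs f))) refl) (sym (*-distribˡ-+ c (Zs f + Xs f) (Ys f))))

  sumV-neg : (f : V s t n → ℤ) → sumV (λ v → - f v) ≡ - sumV f
  sumV-neg f =
    trans (sumV-cong (λ v → sym (-1*i≡-i (f v)))) (trans (sumV-*ˡ (- + 1) f) (-1*i≡-i _))

  sumV-- : (f g : V s t n → ℤ) → sumV (λ v → f v - g v) ≡ sumV f - sumV g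
  sumV-- f g = trans (sumV-+ f (λ v → - g v)) (cong (_+_ (sumV f)) (sumV-neg g))

  sumV-zero : {f : V s t n → ℤ} → (∀ v → f v ≡ + 0) → sumV f ≡ + 0
  sumV-zero eq = trans (sumV-cong eq) (sumV-*ˡ (+ 0) (λ _ → + 0))

  sumV-single : (f : V s t n → ℤ) (u : V s t n) → (∀ v → v ≢ u → f v ≡ + 0) → sumV f ≡ f u
  sumV-single f (z j i) off =
    trans (cong₂ _+_ (cong₂ _+_ (sum2-single _ j i λ j′ i′ ne → off (z j′ i′) λ { refl → ne refl })
                                (sum2-zero λ j′ i′ → off (x j′ i′) λ ()))
                     (sum2-zero λ j′ i′ → off (y j′ i′) λ ()))
          (trans (+-identityʳ _) (+-identityʳ _))
  sumV-single f (x j i) off =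
    trans (cong₂ _+_ (cong₂ _+_ (sum2-zero λ j′ i′ → off (z j′ i′) λ ())
                                (sum2-single _ j i λ j′ i′ ne → off (x j′ i′) λ { refl → ne refl }))
                     (sum2-zero λ j′ i′ → off (y j′ i′) λ ()))
          (trans (+-identityʳ _) (+-identityˡ _))
  sumV-single f (y j i) off =
    trans (cong₂ _+_ (cong₂ _+_ (sum2-zero λ j′ i′ → off (z j′ i′) λ ())
                                (sum2-zero λ j′ i′ → off (x j′ i′) λ ()))
                     (sum2-single _ j i λ j′ i′ ne → off (y j′ i′) λ { refl → ne refl }))
          (+-identityˡ _)

  sumV≤term : {f : V s t n → ℤ} → (∀ v → f v ≤ + 0) → ∀ u → sumV f ≤ f u
  sumV≤term f≤0 (z j i) =
    ≤-trans (i+j≤i _ (sum2-nonpos (λ j i → f≤0 (y j i))))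
    (≤-trans (i+j≤i _ (sum2-nonpos (λ j i → f≤0 (x j i)))) (sum2≤term (λ j i → f≤0 (z j i)) j i))
  sumV≤term f≤0 (x j i) =
    ≤-trans (i+j≤i _ (sum2-nonpos (λ j i → f≤0 (y j i))))
    (≤-trans (i+j≤j _ (sum2-nonpos (λ j i → f≤0 (z j i)))) (sum2≤term (λ j i → f≤0 (x j i)) j i))
  sumV≤term f≤0 (y j i) =
    ≤-trans (i+j≤j _ (+-mono-≤ (sum2-nonpos (λ j i → f≤0 (z j i))) (sum2-nonpos (λ j i → f≤0 (x j i)))))
            (sum2≤term (λ j i → f≤0 (y j i)) j i)

indicator : {P : Set} → Dec P → ℤ
indicator (yes _) = + 1
indicator (no _)  = + 0

indicator-yes : {P : Set} (P? : Dec P) → P → indicator P? ≡ + 1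
indicator-yes (yes _) _ = refl
indicator-yes (no ¬p) p = contradiction p ¬p

indicator-no : {P : Set} (P? : Dec P) → ¬ P → indicator P? ≡ + 0
indicator-no (yes p) ¬p = contradiction p ¬p
indicator-no (no _)  _  = refl

sum2-indicator-row : (j : Fin k) (f : Fin k → Fin m → ℤ) →
                     sum2 (λ j′ i → indicator (j Fin.≟ j′) * f j′ i) ≡ sumFin (f j)
sum2-indicator-row j f =
  trans (sumFin-single _ j (λ j′ j′≢j → sumFin-zero (λ i →
           cong (_* f j′ i) (indicator-no (j Fin.≟ j′) (j′≢j ∘ sym)))))
        (sumFin-cong (λ i → trans (cong (_* f j i) (indicator-yes (j Fin.≟ j) refl)) (*-identityˡ (f j i))))

module _ {s t n : ℕ} where

  unit : V s t n → V s t n → ℤ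
  unit u v = indicator (u ≟V v)

  unit-refl : (u : V s t n) → unit u u ≡ + 1
  unit-refl u = indicator-yes (u ≟V u) refl

  unit-≢ : {u v : V s t n} → u ≢ v → unit u v ≡ + 0
  unit-≢ {u} {v} = indicator-no (u ≟V v)

  sumFin-unit-other : (u : V s t n) (c : Fin m → V s t n) → (∀ i → u ≢ c i) →
                      sumFin (λ i → unit u (c i)) ≡ + 0
  sumFin-unit-other u c u≢c = sumFin-zero (λ i → unit-≢ (u≢c i))

  sumFin-unit-row : (c : Fin k → Fin n → V s t n) →
                    (∀ {j i j′ i′} → c j i ≡ c j′ i′ → j ≡ j′ × i ≡ i′) →
                    ∀ j i j′ → sumFin (λ i′ → unit (c j i) (c j′ i′)) ≡ indicator (j Fin.≟ j′)
  sumFin-unit-row c c-injective j i j′ with j Fin.≟ j′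
  ... | yes refl =
    trans (sumFin-single (λ i′ → unit (c j i) (c j i′)) i
                         (λ i′ i′≢i → unit-≢ (i′≢i ∘ sym ∘ proj₂ ∘ c-injective {j} {i} {j} {i′})))
          (unit-refl (c j i))
  ... | no j≢j′  =
    sumFin-unit-other (c j i) (c j′) (λ i′ → j≢j′ ∘ proj₁ ∘ c-injective {j} {i} {j′} {i′})

  grid : (Fin k → Fin n → V s t n) → List (V s t n)
  grid c = cartesianProductWith c (allFin _) (allFin n)

  vertices : List (V s t n)
  vertices = grid z ++ grid x ++ grid y

  ∈-grid : (c : Fin k → Fin n → V s t n) → ∀ j i → c j i ∈ grid c
  ∈-grid c j i = ∈-cartesianProductWith⁺ c (∈-allFin j) (∈-allFin i)

  ∈-vertices : ∀ v → v ∈ vertices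
  ∈-vertices (z j i) = ∈-++⁺ˡ (∈-grid z j i)
  ∈-vertices (x j i) = ∈-++⁺ʳ (grid z) (∈-++⁺ˡ (∈-grid x j i))
  ∈-vertices (y j i) = ∈-++⁺ʳ (grid z) (∈-++⁺ʳ (grid x) (∈-grid y j i))

  maximum-exists : (d : V s t n → ℤ) → V s t n → ∃ λ M → ∀ v → d v ≤ d M
  maximum-exists d v₀ =
    argmax d v₀ vertices , λ v → lookup (f[xs]≤f[argmax] v₀ vertices) (∈-vertices v)

  imbalance : (V s t n → ℤ) → Fin t → ℤ
  imbalance a j = sumFin (λ i → a (x j i)) - sumFin (λ i → a (y j i))

  imbalance-+ : ∀ a b j → imbalance (λ v → a v + b v) j ≡ imbalance a j + imbalance b j
  imbalance-+ a b j =
    trans (cong₂ _-_ (sumFin-+ (λ i → a (x j i)) (λ i → b (x j i)))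
                     (sumFin-+ (λ i → a (y j i)) (λ i → b (y j i))))
          (regroup (sumFin (λ i → a (x j i))) (sumFin (λ i → b (x j i)))
                   (sumFin (λ i → a (y j i))) (sumFin (λ i → b (y j i))))
    where
    regroup : ∀ p q r u → (p + q) - (r + u) ≡ (p - r) + (q - u)
    regroup = solve-∀

  imbalance-neg : ∀ a j → imbalance (λ v → - a v) j ≡ - imbalance a j
  imbalance-neg a j =
    trans (cong₂ _-_ (sumFin-neg (λ i → a (x j i))) (sumFin-neg (λ i → a (y j i))))
          (sym (neg-distrib-+ (sumFin (λ i → a (x j i))) (- sumFin (λ i → a (y j i)))))

  imbalance-- : ∀ a b j → imbalance (λ v → a v - b v) j ≡ imbalance a j - imbalance b j
  imbalance-- a b j = trans (imbalance-+ a (λ v → - b v) j) (cong (_+_ (imbalance a j)) (imbalance-neg b j))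

  imbalance-constant : ∀ {a} → (∀ u v → a u ≡ a v) → ∀ j → imbalance a j ≡ + 0
  imbalance-constant {a} const j =
    trans (cong (_- sumFin (λ i → a (y j i))) (sumFin-cong (λ i → const (x j i) (y j i))))
          (+-inverseʳ (sumFin (λ i → a (y j i))))

  imbalance-zero : ∀ j → imbalance (λ _ → + 0) j ≡ + 0
  imbalance-zero = imbalance-constant (λ _ _ → refl)

  imbalance-unit-z : ∀ j i j′ → imbalance (unit (z j i)) j′ ≡ + 0
  imbalance-unit-z j i j′ =
    cong₂ _-_ (sumFin-unit-other (z j i) (x j′) (λ _ ())) (sumFin-unit-other (z j i) (y j′) (λ _ ()))

  imbalance-unit-x : ∀ j i j′ → imbalance (unit (x j i)) j′ ≡ indicator (j Fin.≟ j′)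
  imbalance-unit-x j i j′ =
    trans (cong₂ _-_ (sumFin-unit-row x (λ { refl → refl , refl }) j i j′)
                     (sumFin-unit-other (x j i) (y j′) (λ _ ())))
          (+-identityʳ _)

  imbalance-unit-y : ∀ j i j′ → imbalance (unit (y j i)) j′ ≡ - indicator (j Fin.≟ j′)
  imbalance-unit-y j i j′ =
    trans (cong₂ _-_ (sumFin-unit-other (y j i) (x j′) (λ _ ()))
                     (sumFin-unit-row y (λ { refl → refl , refl }) j i j′))
          (+-identityˡ _)

  xPart yPart : Fin t → V s t n → ℤ
  xPart j (x j′ _) = indicator (j Fin.≟ j′)
  xPart j _        = + 0
  yPart j (y j′ _) = indicator (j Fin.≟ j′)
  yPart j _        = + 0

  imbalance-xPart : ∀ j j′ → imbalance (xPart j) j′ ≡ indicator (j Fin.≟ j′) * + n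
  imbalance-xPart j j′ =
    trans (cong₂ _-_ (sumFin-const {n} δ) (sumFin-zero {n} {λ _ → + 0} (λ _ → refl)))
          (trans (+-identityʳ (+ n * δ)) (*-comm (+ n) δ))
    where δ = indicator (j Fin.≟ j′)

  imbalance-yPart : ∀ j j′ → imbalance (yPart j) j′ ≡ - indicator (j Fin.≟ j′) * + n
  imbalance-yPart j j′ =
    trans (cong₂ _-_ (sumFin-zero {n} {λ _ → + 0} (λ _ → refl)) (sumFin-const {n} δ))
          (trans (+-identityˡ (- (+ n * δ))) (trans (cong -_ (*-comm (+ n) δ)) (neg-distribˡ-* δ (+ n))))
    where δ = indicator (j Fin.≟ j′)

module _ {s t n : ℕ} {I : Set} {gen : I → Div s t n} where

  ∈⟨⟩-respects : ∀ {D E} → D ∈⟨ gen ⟩ → (∀ w → E w ≡ D w) → E ∈⟨ gen ⟩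
  ∈⟨⟩-respects (sg-zero p)    eq = sg-zero (λ w → trans (eq w) (p w))
  ∈⟨⟩-respects (sg-gen i p)   eq = sg-gen i (λ w → trans (eq w) (p w))
  ∈⟨⟩-respects (sg-add P Q p) eq = sg-add P Q (λ w → trans (eq w) (p w))
  ∈⟨⟩-respects (sg-neg P p)   eq = sg-neg P (λ w → trans (eq w) (p w))

  ∈⟨⟩-gen : ∀ i → gen i ∈⟨ gen ⟩
  ∈⟨⟩-gen i = sg-gen i (λ _ → refl)

  ∈⟨⟩-+ : ∀ {D E} → D ∈⟨ gen ⟩ → E ∈⟨ gen ⟩ → (λ w → D w + E w) ∈⟨ gen ⟩
  ∈⟨⟩-+ P Q = sg-add P Q (λ _ → refl)

  ∈⟨⟩-neg : ∀ {D} → D ∈⟨ gen ⟩ → (λ w → - D w) ∈⟨ gen ⟩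
  ∈⟨⟩-neg P = sg-neg P (λ _ → refl)

  ∈⟨⟩-- : ∀ {D E} → D ∈⟨ gen ⟩ → E ∈⟨ gen ⟩ → (λ w → D w - E w) ∈⟨ gen ⟩
  ∈⟨⟩-- P Q = ∈⟨⟩-+ P (∈⟨⟩-neg Q)

  ∈⟨⟩-*ℕ : ∀ {D} k → D ∈⟨ gen ⟩ → (λ w → + k * D w) ∈⟨ gen ⟩
  ∈⟨⟩-*ℕ     zero    P = sg-zero (λ _ → refl)
  ∈⟨⟩-*ℕ {D} (suc k) P = ∈⟨⟩-respects (∈⟨⟩-+ P (∈⟨⟩-*ℕ k P)) (λ w → suc-* (+ k) (D w))

  ∈⟨⟩-* : ∀ {D} c → D ∈⟨ gen ⟩ → (λ w → c * D w) ∈⟨ gen ⟩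
  ∈⟨⟩-*     (+ k)    P = ∈⟨⟩-*ℕ k P
  ∈⟨⟩-* {D} -[1+ k ] P =
    ∈⟨⟩-respects (∈⟨⟩-neg (∈⟨⟩-*ℕ (suc k) P)) (λ w → sym (neg-distribˡ-* (+ suc k) (D w)))

  ∈⟨⟩-sumFin : {Ds : Fin m → Div s t n} → (∀ i → Ds i ∈⟨ gen ⟩) →
               (λ w → sumFin (λ i → Ds i w)) ∈⟨ gen ⟩
  ∈⟨⟩-sumFin {zero}  _  = sg-zero (λ _ → refl)
  ∈⟨⟩-sumFin {suc m} Ps = ∈⟨⟩-+ (Ps zero) (∈⟨⟩-sumFin (Ps ∘ suc))

  ∈⟨⟩-sumV : {Ds : V s t n → Div s t n} → (∀ v → Ds v ∈⟨ gen ⟩) →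
             (λ w → sumV (λ v → Ds v w)) ∈⟨ gen ⟩
  ∈⟨⟩-sumV {Ds} Ps = ∈⟨⟩-+ (∈⟨⟩-+ (block z) (block x)) (block y)
    where
    block : (c : Fin k → Fin n → V s t n) → (λ w → sum2 (λ j i → Ds (c j i) w)) ∈⟨ gen ⟩
    block c = ∈⟨⟩-sumFin (λ j → ∈⟨⟩-sumFin (λ i → Ps (c j i)))

  -- With c i a firing script of gen i, a derivation of D ∈ ⟨gen⟩ spells out a firing script of D.
  script : (I → V s t n → ℤ) → ∀ {D} → D ∈⟨ gen ⟩ → V s t n → ℤ
  script c (sg-zero _)    _ = + 0
  script c (sg-gen i _)     = c i
  script c (sg-add P Q _) v = script c P v + script c Q v
  script c (sg-neg P _)   v = - script c P v

  script-divisible : ∀ {c D} q j → (∀ i → q ∣ imbalance (c i) j) →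
                     (P : D ∈⟨ gen ⟩) → q ∣ imbalance (script c P) j
  script-divisible q j q∣ (sg-zero _)        = divides (+ 0) (imbalance-zero {s = s} {n = n} j)
  script-divisible q j q∣ (sg-gen i _)       = q∣ i
  script-divisible {c} q j q∣ (sg-add P Q _) =
    subst (q ∣_) (sym (imbalance-+ (script c P) (script c Q) j))
          (∣m∣n⇒∣m+n (script-divisible q j q∣ P) (script-divisible q j q∣ Q))
  script-divisible {c} q j q∣ (sg-neg P _)   =
    subst (q ∣_) (sym (imbalance-neg (script c P) j)) (∣m⇒∣-m (script-divisible q j q∣ P))

≡⇒congruent : ∀ {n a b} → a ≡ b → + n Unsigned.∣ a - b
≡⇒congruent {n} {b = b} refl = ∣⇒∣ᵤ {+ n} (divides (+ 0) (+-inverseʳ b))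

-- Firing scripts on a connected graph

module _ {s t n : ℕ} .{{_ : NonZero n}} (G : DnGraph s t n) where
  open DnGraph G

  fire : (V s t n → ℤ) → Div s t n
  fire a w = sumV (λ v → a v * Δ G v w)

  fire-+ : ∀ a b w → fire (λ v → a v + b v) w ≡ fire a w + fire b w
  fire-+ a b w = trans (sumV-cong (λ v → *-distribʳ-+ (Δ G v w) (a v) (b v)))
                       (sumV-+ (λ v → a v * Δ G v w) (λ v → b v * Δ G v w))

  fire-neg : ∀ a w → fire (λ v → - a v) w ≡ - fire a w
  fire-neg a w = trans (sumV-cong (λ v → sym (neg-distribˡ-* (a v) (Δ G v w))))
                       (sumV-neg (λ v → a v * Δ G v w))

  fire-- : ∀ a b w → fire (λ v → a v - b v) w ≡ fire a w - fire b w
  fire-- a b w = trans (fire-+ a (λ v → - b v) w) (cong (_+_ (fire a w)) (fire-neg b w))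

  fire-zero : ∀ w → fire (λ _ → + 0) w ≡ + 0
  fire-zero w = sumV-zero {f = λ v → + 0 * Δ G v w} (λ _ → refl)

  fire-unit : ∀ u w → fire (unit u) w ≡ Δ G u w
  fire-unit u w =
    trans (sumV-single (λ v → unit u v * Δ G v w) u (λ v v≢u → cong (_* Δ G v w) (unit-≢ (v≢u ∘ sym))))
          (trans (cong (_* Δ G u w) (unit-refl u)) (*-identityˡ (Δ G u w)))

  fire∈𝓛 : ∀ a → fire a ∈⟨ LGen G ⟩
  fire∈𝓛 a = ∈⟨⟩-sumV (λ v → ∈⟨⟩-* (a v) (∈⟨⟩-gen v))

  -- Summed over v, the bracket becomes d w · deg w - d w · deg w = 0.
  firing-term : ∀ (d : V s t n → ℤ) w v →
                d v * Δ G v w ≡ + adj w v * (d v - d w) + (d w * + adj w v - unit v w * (d w * deg G w))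
  firing-term d w v with v ≟V w
  ... | yes refl rewrite no-loops v = self (d v) (deg G v)
    where
    self : ∀ a D → a * - D ≡ + 0 * (a - a) + (a * + 0 - + 1 * (a * D))
    self = solve-∀
  ... | no _     rewrite adj-sym v w = other (d v) (d w) (+ adj w v) (d w * deg G w)
    where
    other : ∀ a b A K → a * A ≡ A * (a - b) + (b * A - + 0 * K)
    other = solve-∀

  fire-as-flow : ∀ d w → fire d w ≡ sumV (λ v → + adj w v * (d v - d w))
  fire-as-flow d w = begin
    fire d w                                                ≡⟨ sumV-cong (firing-term d w) ⟩
    sumV (λ v → flow v + (d w * + adj w v - unit v w * K))
      ≡⟨ sumV-+ flow (λ v → d w * + adj w v - unit v w * K) ⟩
    sumV flow + sumV (λ v → d w * + adj w v - unit v w * K)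
      ≡⟨ cong (_+_ (sumV flow)) (sumV-- (λ v → d w * + adj w v) (λ v → unit v w * K)) ⟩
    sumV flow + (sumV (λ v → d w * + adj w v) - sumV (λ v → unit v w * K))
      ≡⟨ cong (_+_ (sumV flow)) (cong₂ _-_ (sumV-*ˡ (d w) (λ v → + adj w v)) selfTerm) ⟩
    sumV flow + (K - K)                                     ≡⟨ cong (_+_ (sumV flow)) (+-inverseʳ K) ⟩
    sumV flow + + 0                                         ≡⟨ +-identityʳ (sumV flow) ⟩
    sumV flow                                               ∎
    where
    open ≡-Reasoning
    K : ℤ
    K = d w * deg G w
    flow : V s t n → ℤ
    flow v = + adj w v * (d v - d w)
    selfTerm : sumV (λ v → unit v w * K) ≡ K
    selfTerm = trans (sumV-single (λ v → unit v w * K) w (λ v v≢w → cong (_* K) (unit-≢ v≢w)))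
                     (trans (cong (_* K) (unit-refl w)) (*-identityˡ K))

  maximum-principle : ∀ d → (∀ w → fire d w ≡ + 0) → ∀ {w} → (∀ v → d v ≤ d w) →
                      ∀ v → 0 ℕ.< adj w v → d v ≡ d w
  maximum-principle d fire≡0 {w} d≤dw v adj>0 = i-j≡0⇒i≡j (d v) (d w) difference≡0
    where
    flow : V s t n → ℤ
    flow u = + adj w u * (d u - d w)
    flow≤0 : ∀ u → flow u ≤ + 0
    flow≤0 u = ≤-trans (*-monoˡ-≤-nonNeg (+ adj w u) (i≤j⇒i-j≤0 (d≤dw u)))
                       (≤-reflexive (*-zeroʳ (+ adj w u)))
    flow≡0 : flow v ≡ + 0
    flow≡0 = ≤-antisym (flow≤0 v)
               (≤-trans (≤-reflexive (trans (sym (fire≡0 w)) (fire-as-flow d w))) (sumV≤term flow≤0 v))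
    difference≡0 : d v - d w ≡ + 0
    difference≡0 with i*j≡0⇒i≡0∨j≡0 (+ adj w v) flow≡0
    ... | inj₁ adj≡0 = contradiction (+-injective adj≡0) (ℕ.>⇒≢ adj>0)
    ... | inj₂ eq    = eq

  fire≡0⇒constant : ∀ d → (∀ w → fire d w ≡ + 0) → ∀ u v → d u ≡ d v
  fire≡0⇒constant d fire≡0 u v = trans (reach-max (connected M u)) (sym (reach-max (connected M v)))
    where
    M : V s t n
    M = proj₁ (maximum-exists d u)
    d≤dM : ∀ v → d v ≤ d M
    d≤dM = proj₂ (maximum-exists d u)
    reach-max : ∀ {v} → Reachable adj M v → d v ≡ d M
    reach-max here = refl
    reach-max (step r adj>0) =
      trans (maximum-principle d fire≡0 (λ v → subst (d v ≤_) (sym (reach-max r)) (d≤dM v)) _ adj>0)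
            (reach-max r)

  imbalance-resp-fire : ∀ a b → (∀ w → fire a w ≡ fire b w) → ∀ j → imbalance a j ≡ imbalance b j
  imbalance-resp-fire a b fire≡ j = i-j≡0⇒i≡j _ _ (begin
    imbalance a j - imbalance b j  ≡⟨ sym (imbalance-- a b j) ⟩
    imbalance a-b j                ≡⟨ imbalance-constant (fire≡0⇒constant a-b fire-a-b≡0) j ⟩
    + 0                            ∎)
    where
    open ≡-Reasoning
    a-b : V s t n → ℤ
    a-b v = a v - b v
    fire-a-b≡0 : ∀ w → fire a-b w ≡ + 0
    fire-a-b≡0 w = trans (fire-- a b w) (trans (cong (_- fire b w) (fire≡ w)) (+-inverseʳ (fire b w)))

  script-sound : ∀ {I} {gen : I → Div s t n} {c : I → V s t n → ℤ} →
                 (∀ i w → gen i w ≡ fire (c i) w) →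
                 ∀ {D} (P : D ∈⟨ gen ⟩) w → D w ≡ fire (script c P) w
  script-sound gen≡ (sg-zero p)    w = trans (p w) (sym (fire-zero w))
  script-sound gen≡ (sg-gen i p)   w = trans (p w) (gen≡ i w)
  script-sound {c = c} gen≡ (sg-add P Q p) w =
    trans (p w) (trans (cong₂ _+_ (script-sound gen≡ P w) (script-sound gen≡ Q w))
                       (sym (fire-+ (script c P) (script c Q) w)))
  script-sound {c = c} gen≡ (sg-neg P p)   w =
    trans (p w) (trans (cong -_ (script-sound gen≡ P w)) (sym (fire-neg (script c P) w)))

  firingScript : ∀ {D} → D ∈⟨ LGen G ⟩ → V s t n → ℤ
  firingScript = script unit

  firingScript-sound : ∀ {D} (P : D ∈⟨ LGen G ⟩) w → D w ≡ fire (firingScript P) w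
  firingScript-sound = script-sound (λ v w → sym (fire-unit v w))

  firingScript-difference : ∀ {D E} (P : D ∈⟨ LGen G ⟩) (R : E ∈⟨ LGen G ⟩) w →
                            D w - E w ≡ fire (λ v → firingScript P v - firingScript R v) w
  firingScript-difference P R w =
    trans (cong₂ _-_ (firingScript-sound P w) (firingScript-sound R w))
          (sym (fire-- (firingScript P) (firingScript R) w))

  fire-xPart : ∀ j w → fire (xPart j) w ≡ sumFin (λ i → Δ G (x j i) w)
  fire-xPart j w =
    trans (cong₂ _+_ (cong₂ _+_ (sum2-zero {f = λ j′ i → + 0 * Δ G (z j′ i) w} (λ _ _ → refl))
                                (sum2-indicator-row j (λ j′ i → Δ G (x j′ i) w)))
                     (sum2-zero {f = λ j′ i → + 0 * Δ G (y j′ i) w} (λ _ _ → refl)))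
          (trans (+-identityʳ _) (+-identityˡ _))

  fire-yPart : ∀ j w → fire (yPart j) w ≡ sumFin (λ i → Δ G (y j i) w)
  fire-yPart j w =
    trans (cong₂ _+_ (cong₂ _+_ (sum2-zero {f = λ j′ i → + 0 * Δ G (z j′ i) w} (λ _ _ → refl))
                                (sum2-zero {f = λ j′ i → + 0 * Δ G (x j′ i) w} (λ _ _ → refl)))
                     (sum2-indicator-row j (λ j′ i → Δ G (y j′ i) w)))
          (+-identityˡ _)

  L'GenScript : L'Index G → V s t n → ℤ
  L'GenScript (gz j i)        = unit (z j i)
  L'GenScript (gxy j i₁ i₂) v = unit (x j i₁) v + unit (y j i₂) v
  L'GenScript (gxs j)         = xPart j
  L'GenScript (gys j)         = yPart j

  L'GenScript-sound : ∀ g w → L'Gen G g w ≡ fire (L'GenScript g) w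
  L'GenScript-sound (gz j i)      w = sym (fire-unit (z j i) w)
  L'GenScript-sound (gxy j i₁ i₂) w =
    sym (trans (fire-+ (unit (x j i₁)) (unit (y j i₂)) w)
               (cong₂ _+_ (fire-unit (x j i₁) w) (fire-unit (y j i₂) w)))
  L'GenScript-sound (gxs j)       w = sym (fire-xPart j w)
  L'GenScript-sound (gys j)       w = sym (fire-yPart j w)

  L'GenScript-divisible : ∀ g j → + n ∣ imbalance (L'GenScript g) j
  L'GenScript-divisible (gz j i)      j′ = divides (+ 0) (imbalance-unit-z j i j′)
  L'GenScript-divisible (gxy j i₁ i₂) j′ = divides (+ 0) (begin
    imbalance (λ v → unit (x j i₁) v + unit (y j i₂) v) j′
      ≡⟨ imbalance-+ (unit (x j i₁)) (unit (y j i₂)) j′ ⟩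
    imbalance (unit (x j i₁)) j′ + imbalance (unit (y j i₂)) j′
      ≡⟨ cong₂ _+_ (imbalance-unit-x j i₁ j′) (imbalance-unit-y j i₂ j′) ⟩
    indicator (j Fin.≟ j′) - indicator (j Fin.≟ j′)
      ≡⟨ +-inverseʳ (indicator (j Fin.≟ j′)) ⟩
    + 0 ∎)
    where open ≡-Reasoning
  L'GenScript-divisible (gxs j)       j′ =
    divides (indicator (j Fin.≟ j′)) (imbalance-xPart {s = s} {n = n} j j′)
  L'GenScript-divisible (gys j)       j′ =
    divides (- indicator (j Fin.≟ j′)) (imbalance-yPart {s = s} {n = n} j j′)

  fire∈L'⇒divisible : ∀ a → fire a ∈⟨ L'Gen G ⟩ → ∀ j → + n ∣ imbalance a j
  fire∈L'⇒divisible a P j =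
    subst (+ n ∣_) (imbalance-resp-fire (script L'GenScript P) a (sym ∘ script-sound L'GenScript-sound P) j)
          (script-divisible (+ n) j (λ g → L'GenScript-divisible g j) P)

  module _ (i₀ : Fin n) where

    collapse : V s t n → Div s t n
    collapse (z _ _) _ = + 0
    collapse (x j _) w = Δ G (x j i₀) w
    collapse (y j _) w = - Δ G (x j i₀) w

    Δ-collapse∈L' : ∀ v → (λ w → Δ G v w - collapse v w) ∈⟨ L'Gen G ⟩
    Δ-collapse∈L' (z j i) = ∈⟨⟩-respects (∈⟨⟩-gen (gz j i)) (λ w → +-identityʳ (Δ G (z j i) w))
    Δ-collapse∈L' (x j i) =
      ∈⟨⟩-respects (∈⟨⟩-- (∈⟨⟩-gen (gxy j i i₀)) (∈⟨⟩-gen (gxy j i₀ i₀)))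
                   (λ w → pair-difference (Δ G (x j i) w) (Δ G (x j i₀) w) (Δ G (y j i₀) w))
      where
      pair-difference : ∀ a b c → a - b ≡ (a + c) - (b + c)
      pair-difference = solve-∀
    Δ-collapse∈L' (y j i) =
      ∈⟨⟩-respects (∈⟨⟩-gen (gxy j i₀ i)) (λ w → swap (Δ G (y j i) w) (Δ G (x j i₀) w))
      where
      swap : ∀ a b → a - - b ≡ b + a
      swap = solve-∀

    fire-collapse∈L' : ∀ a → (λ w → fire a w - sumV (λ v → a v * collapse v w)) ∈⟨ L'Gen G ⟩
    fire-collapse∈L' a =
      ∈⟨⟩-respects (∈⟨⟩-sumV (λ v → ∈⟨⟩-* (a v) (Δ-collapse∈L' v)))
                   (λ w → trans (sym (sumV-- (λ v → a v * Δ G v w) (λ v → a v * collapse v w)))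
                                (sumV-cong (λ v → sym (x[y-z]≈xy-xz (a v) (Δ G v w) (collapse v w)))))

    collapse-sum : ∀ a w →
                   sumV (λ v → a v * collapse v w) ≡ sumFin (λ j → imbalance a j * Δ G (x j i₀) w)
    collapse-sum a w = begin
      (sum2 (λ j i → a (z j i) * + 0) + sum2 (λ j i → a (x j i) * X j)) + sum2 (λ j i → a (y j i) * - X j)
        ≡⟨ cong₂ _+_ (cong₂ _+_ (sum2-zero (λ j i → *-zeroʳ (a (z j i))))
                                (sumFin-cong (λ j → sumFin-*ʳ (X j) (λ i → a (x j i)))))
                     (sumFin-cong (λ j → sumFin-*ʳ (- X j) (λ i → a (y j i)))) ⟩
      (+ 0 + sumFin (λ j → A j * X j)) + sumFin (λ j → B j * - X j)
        ≡⟨ cong₂ _+_ (+-identityˡ (sumFin (λ j → A j * X j))) refl ⟩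
      sumFin (λ j → A j * X j) + sumFin (λ j → B j * - X j)
        ≡⟨ sym (sumFin-+ (λ j → A j * X j) (λ j → B j * - X j)) ⟩
      sumFin (λ j → A j * X j + B j * - X j)
        ≡⟨ sumFin-cong (λ j → factor (A j) (B j) (X j)) ⟩
      sumFin (λ j → imbalance a j * X j) ∎
      where
      open ≡-Reasoning
      X A B : Fin t → ℤ
      X j = Δ G (x j i₀) w
      A j = sumFin (λ i → a (x j i))
      B j = sumFin (λ i → a (y j i))
      factor : ∀ A B X → A * X + B * - X ≡ (A - B) * X
      factor = solve-∀

    nΔ∈L' : ∀ j → (λ w → + n * Δ G (x j i₀) w) ∈⟨ L'Gen G ⟩
    nΔ∈L' j =
      ∈⟨⟩-respects (∈⟨⟩-- (∈⟨⟩-gen (gxs j)) (∈⟨⟩-sumFin (λ i → Δ-collapse∈L' (x j i))))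
                   sum-of-differences
      where
      sum-of-differences : ∀ w → + n * Δ G (x j i₀) w ≡
                                 sumFin (λ i → Δ G (x j i) w) - sumFin (λ i → Δ G (x j i) w - Δ G (x j i₀) w)
      sum-of-differences w =
        trans (telescope S (+ n * X))
              (sym (cong (_-_ S) (trans (sumFin-- (λ i → Δ G (x j i) w) (λ _ → X))
                                        (cong (_-_ S) (sumFin-const {n} X)))))
        where
        S X : ℤ
        S = sumFin (λ i → Δ G (x j i) w)
        X = Δ G (x j i₀) w
        telescope : ∀ a b → b ≡ a - (a - b)
        telescope = solve-∀

    divisible⇒fire∈L' : ∀ a → (∀ j → + n ∣ imbalance a j) → fire a ∈⟨ L'Gen G ⟩
    divisible⇒fire∈L' a n∣ =
      ∈⟨⟩-respects (∈⟨⟩-+ (fire-collapse∈L' a) (∈⟨⟩-sumFin (λ j → multiple j (n∣ j))))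
                   (λ w → trans (split (fire a w) (C w)) (cong (_+_ (fire a w - C w)) (collapse-sum a w)))
      where
      C : Div s t n
      C w = sumV (λ v → a v * collapse v w)
      split : ∀ a b → a ≡ (a - b) + b
      split = solve-∀
      multiple : ∀ j → + n ∣ imbalance a j → (λ w → imbalance a j * Δ G (x j i₀) w) ∈⟨ L'Gen G ⟩
      multiple j (divides q eq) =
        ∈⟨⟩-respects (∈⟨⟩-* q (nΔ∈L' j))
                     (λ w → trans (cong (_* Δ G (x j i₀) w) eq) (*-assoc q (+ n) (Δ G (x j i₀) w)))

    basepoint : (Fin t → ℤ) → V s t n → ℤ
    basepoint c (x j i) = indicator (i Fin.≟ i₀) * c j
    basepoint c _       = + 0

    imbalance-basepoint : ∀ c j → imbalance (basepoint c) j ≡ c j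
    imbalance-basepoint c j =
      trans (cong₂ _-_ (sumFin-single _ i₀ (λ i i≢i₀ → cong (_* c j) (indicator-no (i Fin.≟ i₀) i≢i₀)))
                       (sumFin-zero {n} {λ _ → + 0} (λ _ → refl)))
            (trans (+-identityʳ _)
                   (trans (cong (_* c j) (indicator-yes (i₀ Fin.≟ i₀) refl)) (*-identityˡ (c j))))

  -- The isomorphism 𝓛/𝓛' ≅ (ℤ/nℤ)^t

  imbalanceMap : 𝓛 G → Fin t → ℤ
  imbalanceMap (_ , P) = imbalance (firingScript P)

  imbalanceMap-fire : ∀ a (P : fire a ∈⟨ LGen G ⟩) j → imbalanceMap (fire a , P) j ≡ imbalance a j
  imbalanceMap-fire a P j = imbalance-resp-fire (firingScript P) a (λ w → sym (firingScript-sound P w)) j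

  imbalanceMap-cong : ∀ {A B : 𝓛 G} → (λ v → proj₁ A v - proj₁ B v) ∈⟨ L'Gen G ⟩ →
                      ∀ j → + n ∣ imbalanceMap A j - imbalanceMap B j
  imbalanceMap-cong {_ , P} {_ , R} A-B∈L' j =
    subst (+ n ∣_) (imbalance-- (firingScript P) (firingScript R) j)
          (fire∈L'⇒divisible (λ v → firingScript P v - firingScript R v)
                             (∈⟨⟩-respects A-B∈L' (sym ∘ firingScript-difference P R)) j)

  imbalanceMap-injective : (i₀ : Fin n) → ∀ {A B : 𝓛 G} →
                           (∀ j → + n ∣ imbalanceMap A j - imbalanceMap B j) →
                           (λ v → proj₁ A v - proj₁ B v) ∈⟨ L'Gen G ⟩
  imbalanceMap-injective i₀ {_ , P} {_ , R} n∣ =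
    ∈⟨⟩-respects (divisible⇒fire∈L' i₀ (λ v → firingScript P v - firingScript R v)
                   (λ j → subst (+ n ∣_) (sym (imbalance-- (firingScript P) (firingScript R) j)) (n∣ j)))
                 (firingScript-difference P R)

  imbalanceMap-isGroupIsomorphism : (i₀ : Fin n) →
                                    GroupMorphisms.IsGroupIsomorphism (𝓛/𝓛' G) (ZnPow n t) imbalanceMap
  imbalanceMap-isGroupIsomorphism i₀ = record
    { isGroupMonomorphism = record
      { isGroupHomomorphism = record
        { isMonoidHomomorphism = record
          { isMagmaHomomorphism = record
            { isRelHomomorphism = record { cong = λ {A} {B} A≈B → ∣⇒∣ᵤ ∘ imbalanceMap-cong {A} {B} A≈B }
            ; homo = λ { (_ , P) (_ , Q) j → ≡⇒congruent (imbalance-+ (firingScript P) (firingScript Q) j) } }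
          ; ε-homo = λ j → ≡⇒congruent (imbalance-zero {s = s} {n = n} j) }
        ; ⁻¹-homo = λ { (_ , P) j → ≡⇒congruent (imbalance-neg (firingScript P) j) } }
      ; injective = λ {A} {B} A≈B → imbalanceMap-injective i₀ {A} {B} (∣ᵤ⇒∣ ∘ A≈B) }
    ; surjective = λ c → let W = fire (basepoint i₀ c) , fire∈𝓛 (basepoint i₀ c) in W , λ {A} A≈W j →
        ∣⇒∣ᵤ (subst (λ b → + n ∣ imbalanceMap A j - b)
                     (trans (imbalanceMap-fire (basepoint i₀ c) (proj₂ W) j) (imbalance-basepoint i₀ c j))
                     (imbalanceMap-cong {A} {W} A≈W j)) }

-- Any base index i₀ serves.
lemma5p3 : (s t n : ℕ) .{{_ : NonZero n}} → 2 ℕ.≤ n → (G : DnGraph s t n) →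
    ∃ (λ f → GroupMorphisms.IsGroupIsomorphism (𝓛/𝓛' G) (ZnPow n t) f)
lemma5p3 s t n _ G = imbalanceMap G , imbalanceMap-isGroupIsomorphism G (mod n 0)
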